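{- Every set of natural numbers definable by a variable-free arithmetic circuit belongs to the bounded hierarchy $\mathrm{BH}$; that is, it is definable in the standard model $(\mathbb{N},+,\cdot,1,0)$ by a formula of bounded arithmetic with one free variable.
   Context: $\mathbb{N}=\{0,1,2,\ldots\}$. For $s,t\subseteq\mathbb{N}$ put $s\oplus t=\{m+n\mid m\in s,\ n\in t\}$ and $s\otimes t=\{m\cdot n\mid m\in s,\ n\in t\}$. A variable-free arithmetic circuit is a term built from the constants $\emptyset$, $\mathbb{N}$ and $\{n\}$ ($n\in\mathbb{N}$) using $\cup,\cap,\oplus,\otimes$ and complement relative to $\mathbb{N}$; it evaluates to the subset of $\mathbb{N}$ it defines. A formula of bounded arithmetic is a first-order formula over the signature $(+,\cdot,1,0)$ in which every quantifier has the form $(\forall x\le t)\varphi$ or $(\exists x\le t)\varphi$ with $t$ a term. The bounded hierarchy $\mathrm{BH}$ is the collection of relations on $\mathbb{N}$ definable by such formulas. -}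

module Defs where

open import Data.Nat using (ℕ; zero; suc; _+_; _*_; _≤_)
open import Data.Fin using (Fin)
open import Data.Vec using (Vec; _∷_; []; lookup)
open import Data.Product using (Σ; _×_; _,_)
open import Data.Sum using (_⊎_)
open import Data.Empty using (⊥)
open import Data.Unit using (⊤)
open import Relation.Nullary using (¬_)
open import Relation.Binary.PropositionalEquality using (_≡_)

data Circuit : Set where
  empty  : Circuit
  nat    : Circuit
  single : ℕ → Circuit
  _∪c_   : Circuit → Circuit → Circuit
  _∩c_   : Circuit → Circuit → Circuit
  _⊕c_   : Circuit → Circuit → Circuit
  _⊗c_   : Circuit → Circuit → Circuit
  compl  : Circuit → Circuit

⟦_⟧ : Circuit → ℕ → Set
⟦ empty ⟧    n = ⊥
⟦ nat ⟧      n = ⊤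
⟦ single k ⟧ n = n ≡ k
⟦ s ∪c t ⟧   n = ⟦ s ⟧ n ⊎ ⟦ t ⟧ n
⟦ s ∩c t ⟧   n = ⟦ s ⟧ n × ⟦ t ⟧ n
⟦ s ⊕c t ⟧   n = Σ ℕ λ a → Σ ℕ λ b → ⟦ s ⟧ a × ⟦ t ⟧ b × n ≡ a + b
⟦ s ⊗c t ⟧   n = Σ ℕ λ a → Σ ℕ λ b → ⟦ s ⟧ a × ⟦ t ⟧ b × n ≡ a * b
⟦ compl s ⟧  n = ¬ ⟦ s ⟧ n

-- Bounded arithmetic over the signature (+, ·, 1, 0), de Bruijn style:
-- Term k / BFormula k have free variables among Fin k.

data Term (k : ℕ) : Set where
  var  : Fin k → Term k
  zer  : Term k
  one  : Term k
  _+ₜ_ : Term k → Term k → Term k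
  _*ₜ_ : Term k → Term k → Term k

-- Bounded quantifiers (∀ x ≤ t) φ and (∃ x ≤ t) φ: the bound t lives in
-- the outer context (so x does not occur in t), φ has x as variable 0.
data BFormula (k : ℕ) : Set where
  _≐_  : Term k → Term k → BFormula k
  ⊥f   : BFormula k
  ¬f_  : BFormula k → BFormula k
  _∧f_ : BFormula k → BFormula k → BFormula k
  _∨f_ : BFormula k → BFormula k → BFormula k
  _⇒f_ : BFormula k → BFormula k → BFormula k
  ∀≤   : Term k → BFormula (suc k) → BFormula k
  ∃≤   : Term k → BFormula (suc k) → BFormula k

evalT : ∀ {k} → Vec ℕ k → Term k → ℕ
evalT ρ (var i)  = lookup ρ i
evalT ρ zer      = 0
evalT ρ one      = 1
evalT ρ (s +ₜ t) = evalT ρ s + evalT ρ t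
evalT ρ (s *ₜ t) = evalT ρ s * evalT ρ t

Sat : ∀ {k} → Vec ℕ k → BFormula k → Set
Sat ρ (s ≐ t)   = evalT ρ s ≡ evalT ρ t
Sat ρ ⊥f        = ⊥
Sat ρ (¬f φ)    = ¬ Sat ρ φ
Sat ρ (φ ∧f ψ)  = Sat ρ φ × Sat ρ ψ
Sat ρ (φ ∨f ψ)  = Sat ρ φ ⊎ Sat ρ ψ
Sat ρ (φ ⇒f ψ)  = Sat ρ φ → Sat ρ ψ
Sat ρ (∀≤ t φ)  = (x : ℕ) → x ≤ evalT ρ t → Sat (x ∷ ρ) φ
Sat ρ (∃≤ t φ)  = Σ ℕ λ x → x ≤ evalT ρ t × Sat (x ∷ ρ) φ

InBH : (ℕ → Set) → Set
InBH P = Σ (BFormula 1) λ φ → (n : ℕ) → (P n → Sat (n ∷ []) φ) × (Sat (n ∷ []) φ → P n)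

module Submission where

-- We translate a circuit C into a family of bounded formulas "xᵢ ∈ C",
-- one for each variable xᵢ of each context, and show by induction on C
-- that the formula holds exactly when the value of xᵢ lies in ⟦ C ⟧.  For s ⊕ t and
-- s ⊗ t the witnesses a, b with n = a ∘ b must be quantified boundedly,
-- which is possible because they can be chosen ≤ n:
--   * n = a + b forces a, b ≤ n;
--   * n = a · b > 0 forces a, b ≤ n;
--   * n = 0 lies in s ⊗ t iff 0 ∈ s and t ≠ ∅, or 0 ∈ t and s ≠ ∅.
-- Non-emptiness of a circuit set is a closed statement, so it is expressed
-- by the formula ⊤ or ⊥ according to its (classically decided) truth value;
-- this is the only place where excluded middle is used.

open import Defs
open import Level using (0ℓ)
open import Axiom.ExcludedMiddle using (ExcludedMiddle)
open import Data.Nat using (ℕ; zero; suc; _+_; _*_; _≤_)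
open import Data.Nat.Properties using (m≤m+n; m≤n+m; m≤m*n; m≤n*m; *-zeroʳ)
open import Data.Fin using (Fin) renaming (zero to fz; suc to fs)
open import Data.Vec using (Vec; _∷_; []; lookup)
open import Data.Product using (Σ; _×_; _,_)
open import Data.Product.Function.NonDependent.Propositional using (_×-⇔_)
open import Data.Sum using (_⊎_; inj₁; inj₂)
open import Data.Sum.Function.Propositional using (_⊎-⇔_)
open import Data.Empty using (⊥)
open import Data.Unit using (tt)
open import Function using (id)
open import Function.Bundles using (_⇔_; mk⇔; Equivalence)
open import Function.Properties.Equivalence using () renaming (trans to ⇔-trans)
open import Function.Related.TypeIsomorphisms using (¬-cong-⇔)
open import Relation.Nullary using (¬_; Dec; yes; no)
open import Relation.Binary.PropositionalEquality using (_≡_; refl; sym; trans; subst; cong)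

open Equivalence using (to; from)

num : ∀ {k} → ℕ → Term k
num zero    = zer
num (suc n) = one +ₜ num n

evalT-num : ∀ {k} (ρ : Vec ℕ k) (n : ℕ) → evalT ρ (num n) ≡ n
evalT-num ρ zero    = refl
evalT-num ρ (suc n) = cong suc (evalT-num ρ n)

Pair : (ℕ → ℕ → ℕ) → (ℕ → Set) → (ℕ → Set) → ℕ → Set
Pair _∘_ P Q n = Σ ℕ λ a → Σ ℕ λ b → P a × Q b × n ≡ a ∘ b

BoundedPair : (ℕ → ℕ → ℕ) → (ℕ → Set) → (ℕ → Set) → ℕ → Set
BoundedPair _∘_ P Q n =
  Σ ℕ λ a → a ≤ n × Σ ℕ λ b → b ≤ n × n ≡ a ∘ b × P a × Q b

NonEmpty : (ℕ → Set) → Set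
NonEmpty P = Σ ℕ P

ZeroProduct : (ℕ → Set) → (ℕ → Set) → ℕ → Set
ZeroProduct P Q n = n ≡ 0 × ((P n × NonEmpty Q) ⊎ (Q n × NonEmpty P))

forget-bounds : ∀ {_∘_ P Q n} → BoundedPair _∘_ P Q n → Pair _∘_ P Q n
forget-bounds (a , _ , b , _ , e , pa , qb) = a , b , pa , qb , e

sum-witnesses-bounded : ∀ {P Q n} → Pair _+_ P Q n ⇔ BoundedPair _+_ P Q n
sum-witnesses-bounded = mk⇔ bound forget-bounds
  where
  bound : ∀ {P Q n} → Pair _+_ P Q n → BoundedPair _+_ P Q n
  bound (a , b , pa , qb , refl) = a , m≤m+n a b , b , m≤n+m b a , refl , pa , qb

product-witnesses : ∀ {P Q n} →
  Pair _*_ P Q n ⇔ (BoundedPair _*_ P Q n ⊎ ZeroProduct P Q n)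
product-witnesses {P} {Q} = mk⇔ split join
  where
  split : ∀ {n} → Pair _*_ P Q n → BoundedPair _*_ P Q n ⊎ ZeroProduct P Q n
  split (zero , b , p0 , qb , n≡0) = inj₂ (n≡0 , inj₁ (subst P (sym n≡0) p0 , b , qb))
  split (a , zero , pa , q0 , e)   =
    let n≡0 = trans e (*-zeroʳ a) in inj₂ (n≡0 , inj₂ (subst Q (sym n≡0) q0 , a , pa))
  split (a@(suc _) , b@(suc _) , pa , qb , e) =
    inj₁ (a , subst (a ≤_) (sym e) (m≤m*n a b) , b , subst (b ≤_) (sym e) (m≤n*m b a) , e , pa , qb)

  join : ∀ {n} → BoundedPair _*_ P Q n ⊎ ZeroProduct P Q n → Pair _*_ P Q n
  join (inj₁ bounded) = forget-bounds bounded
  join (inj₂ (refl , inj₁ (p0 , b , qb))) = 0 , b , p0 , qb , refl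
  join (inj₂ (refl , inj₂ (q0 , a , pa))) = a , 0 , pa , q0 , sym (*-zeroʳ a)

-- A formula family speaks about one distinguished variable xᵢ of an
-- arbitrary context; it expresses P if it holds exactly when P (xᵢ).
Family : Set
Family = ∀ {k} → Fin k → BFormula k

-- It is a record rather than a function type so that P and φ remain
-- inferable from a proof of it.
record Expresses (P : ℕ → Set) (φ : Family) : Set where
  constructor expresses
  field
    meaning : ∀ {k} (ρ : Vec ℕ k) (i : Fin k) → P (lookup ρ i) ⇔ Sat ρ (φ i)
open Expresses using (meaning)

expresses-resp : ∀ {P Q} {φ : Family} → (∀ {n} → P n ⇔ Q n) → Expresses Q φ → Expresses P φ
expresses-resp P⇔Q φ-ok = expresses λ ρ i → ⇔-trans P⇔Q (meaning φ-ok ρ i)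

_∨ᶠ_ _∧ᶠ_ : Family → Family → Family
(φ ∨ᶠ ψ) i = φ i ∨f ψ i
(φ ∧ᶠ ψ) i = φ i ∧f ψ i

¬ᶠ_ : Family → Family
(¬ᶠ φ) i = ¬f φ i

expresses-∨ : ∀ {P Q} {φ ψ : Family} →
  Expresses P φ → Expresses Q ψ → Expresses (λ n → P n ⊎ Q n) (φ ∨ᶠ ψ)
expresses-∨ φ-ok ψ-ok = expresses λ ρ i → meaning φ-ok ρ i ⊎-⇔ meaning ψ-ok ρ i

expresses-∧ : ∀ {P Q} {φ ψ : Family} →
  Expresses P φ → Expresses Q ψ → Expresses (λ n → P n × Q n) (φ ∧ᶠ ψ)
expresses-∧ φ-ok ψ-ok = expresses λ ρ i → meaning φ-ok ρ i ×-⇔ meaning ψ-ok ρ i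

expresses-¬ : ∀ {P} {φ : Family} → Expresses P φ → Expresses (λ n → ¬ P n) (¬ᶠ φ)
expresses-¬ φ-ok = expresses λ ρ i → ¬-cong-⇔ (meaning φ-ok ρ i)

constᶠ : {A : Set} → Dec A → Family
constᶠ (yes _) i = ¬f ⊥f
constᶠ (no _)  i = ⊥f

expresses-const : ∀ {A} (d : Dec A) → Expresses (λ _ → A) (constᶠ d)
expresses-const (yes a) = expresses λ _ _ → mk⇔ (λ _ → id) (λ _ → a)
expresses-const (no ¬a) = expresses λ _ _ → mk⇔ ¬a (λ ())

equalsᶠ : ℕ → Family
equalsᶠ n i = var i ≐ num n

expresses-equals : ∀ n → Expresses (_≡ n) (equalsᶠ n)
expresses-equals n = expresses λ ρ i →
  mk⇔ (λ e → trans e (sym (evalT-num ρ n))) (λ e → trans e (evalT-num ρ n))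

-- The formula ∃ a ≤ xᵢ. ∃ b ≤ xᵢ. xᵢ = a ∘ b ∧ φ(a) ∧ ψ(b), for a term
-- operation _∘ₜ_ interpreting the arithmetic operation _∘_.
witnessPairᶠ : (∀ {k} → Term k → Term k → Term k) → Family → Family → Family
witnessPairᶠ _∘ₜ_ φ ψ i =
  ∃≤ (var i) (∃≤ (var (fs i))
    ((var (fs (fs i)) ≐ (var (fs fz) ∘ₜ var fz)) ∧f (φ (fs fz) ∧f ψ fz)))

-- In the extended context b ∷ a ∷ ρ the variables fz, fs fz, fs (fs i)
-- denote b, a and xᵢ, so the formula means BoundedPair _∘_ P Q (xᵢ).
expresses-witnessPair : ∀ {P Q} {φ ψ : Family}
  (_∘ₜ_ : ∀ {k} → Term k → Term k → Term k) (_∘_ : ℕ → ℕ → ℕ) →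
  (∀ {k} (ρ : Vec ℕ k) u v → evalT ρ (u ∘ₜ v) ≡ evalT ρ u ∘ evalT ρ v) →
  Expresses P φ → Expresses Q ψ → Expresses (BoundedPair _∘_ P Q) (witnessPairᶠ _∘ₜ_ φ ψ)
expresses-witnessPair _∘ₜ_ _∘_ eval-∘ φ-ok ψ-ok = expresses λ ρ i → mk⇔
  (λ (a , a≤ , b , b≤ , e , pa , qb) →
     a , a≤ , b , b≤ , trans e (sym (eval-∘ (b ∷ a ∷ ρ) (var (fs fz)) (var fz))) ,
     to (meaning φ-ok (b ∷ a ∷ ρ) (fs fz)) pa , to (meaning ψ-ok (b ∷ a ∷ ρ) fz) qb)
  (λ (a , a≤ , b , b≤ , e , φa , ψb) →
     a , a≤ , b , b≤ , trans e (eval-∘ (b ∷ a ∷ ρ) (var (fs fz)) (var fz)) ,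
     from (meaning φ-ok (b ∷ a ∷ ρ) (fs fz)) φa , from (meaning ψ-ok (b ∷ a ∷ ρ) fz) ψb)

translate : ExcludedMiddle 0ℓ → Circuit → Family
translate lem empty      = constᶠ {⊥} (no id)
translate lem nat        = constᶠ (yes tt)
translate lem (single n) = equalsᶠ n
translate lem (s ∪c t)   = translate lem s ∨ᶠ translate lem t
translate lem (s ∩c t)   = translate lem s ∧ᶠ translate lem t
translate lem (compl s)  = ¬ᶠ translate lem s
translate lem (s ⊕c t)   = witnessPairᶠ _+ₜ_ (translate lem s) (translate lem t)
translate lem (s ⊗c t)   =
  witnessPairᶠ _*ₜ_ S T ∨ᶠ
  (equalsᶠ 0 ∧ᶠ ((S ∧ᶠ constᶠ (lem {NonEmpty ⟦ t ⟧})) ∨ᶠ (T ∧ᶠ constᶠ (lem {NonEmpty ⟦ s ⟧}))))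
  where
  S T : Family
  S = translate lem s
  T = translate lem t

translate-expresses : (lem : ExcludedMiddle 0ℓ) (C : Circuit) → Expresses ⟦ C ⟧ (translate lem C)
translate-expresses lem empty      = expresses-const (no id)
translate-expresses lem nat        = expresses-const (yes tt)
translate-expresses lem (single n) = expresses-equals n
translate-expresses lem (s ∪c t)   = expresses-∨ (translate-expresses lem s) (translate-expresses lem t)
translate-expresses lem (s ∩c t)   = expresses-∧ (translate-expresses lem s) (translate-expresses lem t)
translate-expresses lem (compl s)  = expresses-¬ (translate-expresses lem s)
translate-expresses lem (s ⊕c t)   =
  expresses-resp sum-witnesses-bounded
    (expresses-witnessPair _+ₜ_ _+_ (λ _ _ _ → refl) (translate-expresses lem s) (translate-expresses lem t))
translate-expresses lem (s ⊗c t)   =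
  expresses-resp product-witnesses
    (expresses-∨ (expresses-witnessPair _*ₜ_ _*_ (λ _ _ _ → refl) S-ok T-ok)
      (expresses-∧ (expresses-equals 0)
        (expresses-∨ (expresses-∧ S-ok (expresses-const lem)) (expresses-∧ T-ok (expresses-const lem)))))
  where
  S-ok : Expresses ⟦ s ⟧ (translate lem s)
  S-ok = translate-expresses lem s
  T-ok : Expresses ⟦ t ⟧ (translate lem t)
  T-ok = translate-expresses lem t

theorem2 : ExcludedMiddle 0ℓ → (C : Circuit) → InBH ⟦ C ⟧
theorem2 lem C = translate lem C fz , λ n → to (correct n) , from (correct n)
  where
  correct : ∀ n → ⟦ C ⟧ n ⇔ Sat (n ∷ []) (translate lem C fz)
  correct n = meaning (translate-expresses lem C) (n ∷ []) fz
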